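{- Let $G$ be a finite bipartite graph, $b:V(G)\to\mathbb{Z}_{\ge0}$, and $M$ a $b$-matching of $G$. If $Z\subseteq V(G)$ satisfies (i) $E[Z]\subseteq M$, (ii) $E[V(G)\setminus Z]\cap M=\emptyset$, and (iii) every $M$-loose vertex belongs to $Z$, then $M$ is a maximum $b$-matching and $Z$ is a $b$-verifying set.
   Context: A $b$-matching is $M\subseteq E(G)$ with at most $b(v)$ edges of $M$ at each vertex $v$; maximum = largest cardinality; $v$ is $M$-loose if fewer than $b(v)$ edges of $M$ are incident with it. For $X\subseteq V(G)$, $E[X]$ is the set of edges with both ends in $X$ and $b(X)=\sum_{v\in X}b(v)$. $Z$ is a $b$-verifying set if $b(V(G)\setminus Z)+|E[Z]|$ equals the size of a maximum $b$-matching. -}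

module Defs where

open import Data.Nat using (ℕ; zero; suc; _+_; _≤_; _<_)
open import Data.Fin using (Fin)
import Data.Fin as F
open import Data.Bool using (Bool; true; false; _∧_; if_then_else_)
open import Data.Sum using (_⊎_; inj₁; inj₂)
open import Data.Product using (_×_; Σ)
open import Relation.Binary.PropositionalEquality using (_≡_)

-- A finite bipartite graph with bipartition (Fin p, Fin q): its vertex set is
-- Fin p ⊎ Fin q and its edge set is given by the adjacency relation E
-- (E i j ≡ true iff {inj₁ i, inj₂ j} is an edge). Edge subsets (e.g. M) are
-- represented the same way, as Bool-valued relations.
Rel : ℕ → ℕ → Set
Rel p q = Fin p → Fin q → Bool

Vertex : ℕ → ℕ → Set
Vertex p q = Fin p ⊎ Fin q

Σ[<_]_ : (n : ℕ) → (Fin n → ℕ) → ℕ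
Σ[< zero ] f = 0
Σ[< suc n ] f = f F.zero + Σ[< n ] (λ i → f (F.suc i))

toℕ : Bool → ℕ
toℕ true = 1
toℕ false = 0

size : ∀ {p q} → Rel p q → ℕ
size {p} {q} R = Σ[< p ] (λ i → Σ[< q ] (λ j → toℕ (R i j)))

deg : ∀ {p q} → Rel p q → Vertex p q → ℕ
deg {p} {q} M (inj₁ i) = Σ[< q ] (λ j → toℕ (M i j))
deg {p} {q} M (inj₂ j) = Σ[< p ] (λ i → toℕ (M i j))

_⊆E_ : ∀ {p q} → Rel p q → Rel p q → Set
M ⊆E E = ∀ i j → M i j ≡ true → E i j ≡ true

IsBMatching : ∀ {p q} → Rel p q → (Vertex p q → ℕ) → Rel p q → Set
IsBMatching E b M = (M ⊆E E) × (∀ v → deg M v ≤ b v)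

IsMaximumBMatching : ∀ {p q} → Rel p q → (Vertex p q → ℕ) → Rel p q → Set
IsMaximumBMatching E b M =
  IsBMatching E b M × (∀ M′ → IsBMatching E b M′ → size M′ ≤ size M)

Loose : ∀ {p q} → (Vertex p q → ℕ) → Rel p q → Vertex p q → Set
Loose b M v = deg M v < b v

bOutside : ∀ {p q} → (Vertex p q → ℕ) → (Vertex p q → Bool) → ℕ
bOutside {p} {q} b Z =
  Σ[< p ] (λ i → if Z (inj₁ i) then 0 else b (inj₁ i)) +
  Σ[< q ] (λ j → if Z (inj₂ j) then 0 else b (inj₂ j))

inducedEdges : ∀ {p q} → Rel p q → (Vertex p q → Bool) → Rel p q
inducedEdges E Z i j = E i j ∧ (Z (inj₁ i) ∧ Z (inj₂ j))

IsBVerifying : ∀ {p q} → Rel p q → (Vertex p q → ℕ) → (Vertex p q → Bool) → Set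
IsBVerifying E b Z =
  Σ _ (λ N → IsMaximumBMatching E b N × (bOutside b Z + size (inducedEdges E Z) ≡ size N))

-- Every edge of a b-matching N either lies in E[Z] or has an end outside Z, and a vertex
-- v ∉ Z carries at most b(v) edges of N; hence |N| ≤ |E[Z]| + b(V ∖ Z).  For M each of
-- these estimates is tight: E[Z] ⊆ M, no edge of M has both ends outside Z (so it is
-- counted once), and the vertices outside Z are not M-loose, i.e. carry exactly b(v)
-- edges of M.  So |M| attains the bound, which makes M maximum and Z b-verifying.
module Submission where

open import Defs
open import Data.Nat using (ℕ; zero; suc; _+_; _≤_; z≤n; s≤s)
open import Data.Nat.Properties
  using (+-0-commutativeMonoid; +-assoc; +-comm; +-mono-≤; ≤-refl; ≤-antisym; ≮⇒≥; module ≤-Reasoning)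
open import Data.Fin using (Fin)
import Data.Fin as F
open import Data.Bool using (Bool; true; false; _∧_; if_then_else_)
open import Data.Bool.Properties using (∧-zeroʳ)
open import Data.Sum using (inj₁; inj₂)
open import Data.Product using (_×_; _,_)
open import Relation.Binary.PropositionalEquality
open import Relation.Nullary using (contradiction)
open import Algebra.Properties.CommutativeMonoid.Sum +-0-commutativeMonoid
  using (sum; sum-cong-≗; sum-replicate-zero; ∑-distrib-+; ∑-comm)

Σ≡sum : ∀ n (f : Fin n → ℕ) → Σ[< n ] f ≡ sum f
Σ≡sum zero    f = refl
Σ≡sum (suc n) f = cong (f F.zero +_) (Σ≡sum n (λ i → f (F.suc i)))

Σ-cong : ∀ n {f g : Fin n → ℕ} → (∀ i → f i ≡ g i) → Σ[< n ] f ≡ Σ[< n ] g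
Σ-cong n {f} {g} f≗g = trans (Σ≡sum n f) (trans (sum-cong-≗ f≗g) (sym (Σ≡sum n g)))

Σ-mono-≤ : ∀ n {f g : Fin n → ℕ} → (∀ i → f i ≤ g i) → Σ[< n ] f ≤ Σ[< n ] g
Σ-mono-≤ zero    f≤g = z≤n
Σ-mono-≤ (suc n) f≤g = +-mono-≤ (f≤g F.zero) (Σ-mono-≤ n (λ i → f≤g (F.suc i)))

Σ-zero : ∀ n → Σ[< n ] (λ _ → 0) ≡ 0
Σ-zero n = trans (Σ≡sum n _) (sum-replicate-zero n)

Σ-distrib-+ : ∀ n (f g : Fin n → ℕ) → Σ[< n ] (λ i → f i + g i) ≡ Σ[< n ] f + Σ[< n ] g
Σ-distrib-+ n f g = begin
  Σ[< n ] (λ i → f i + g i)  ≡⟨ Σ≡sum n _ ⟩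
  sum (λ i → f i + g i)      ≡⟨ ∑-distrib-+ f g ⟩
  sum f + sum g              ≡⟨ sym (cong₂ _+_ (Σ≡sum n f) (Σ≡sum n g)) ⟩
  Σ[< n ] f + Σ[< n ] g      ∎
  where open ≡-Reasoning

Σ-comm : ∀ m n (f : Fin m → Fin n → ℕ) →
  Σ[< m ] (λ i → Σ[< n ] (f i)) ≡ Σ[< n ] (λ j → Σ[< m ] (λ i → f i j))
Σ-comm m n f = begin
  Σ[< m ] (λ i → Σ[< n ] (f i))        ≡⟨ Σ-cong m (λ i → Σ≡sum n (f i)) ⟩
  Σ[< m ] (λ i → sum (f i))            ≡⟨ Σ≡sum m _ ⟩
  sum (λ i → sum (f i))                ≡⟨ ∑-comm f ⟩
  sum (λ j → sum (λ i → f i j))        ≡⟨ sym (Σ≡sum n _) ⟩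
  Σ[< n ] (λ j → sum (λ i → f i j))    ≡⟨ Σ-cong n (λ j → sym (Σ≡sum m _)) ⟩
  Σ[< n ] (λ j → Σ[< m ] (λ i → f i j)) ∎
  where open ≡-Reasoning

Σ-if : ∀ n c (f : Fin n → ℕ) →
  Σ[< n ] (λ i → if c then 0 else f i) ≡ (if c then 0 else Σ[< n ] f)
Σ-if n true  f = Σ-zero n
Σ-if n false f = refl

⇔true⇒≡ : ∀ {r s} → (r ≡ true → s ≡ true) → (s ≡ true → r ≡ true) → r ≡ s
⇔true⇒≡ {false} {false} _   _   = refl
⇔true⇒≡ {true}  {true}  _   _   = refl
⇔true⇒≡ {false} {true}  _   s⇒r = s⇒r refl
⇔true⇒≡ {true}  {false} r⇒s _   = sym (r⇒s refl)

-- What an edge ij (present iff r) contributes to |E[Z]| + Σ_{v ∉ Z} deg v, where zi, zj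
-- record whether its ends lie in Z.
charge : Bool → Bool → Bool → ℕ
charge r zi zj = toℕ (r ∧ (zi ∧ zj)) + (if zi then 0 else toℕ r) + (if zj then 0 else toℕ r)

toℕ≤charge : ∀ r zi zj → toℕ r ≤ charge r zi zj
toℕ≤charge false _     _     = z≤n
toℕ≤charge true  true  true  = ≤-refl
toℕ≤charge true  true  false = ≤-refl
toℕ≤charge true  false _     = s≤s z≤n

toℕ≡charge : ∀ r zi zj → (zi ≡ false → zj ≡ false → r ≡ false) → toℕ r ≡ charge r zi zj
toℕ≡charge false true  true  _ = refl
toℕ≡charge false true  false _ = refl
toℕ≡charge false false true  _ = refl
toℕ≡charge false false false _ = refl
toℕ≡charge true  true  true  _ = refl
toℕ≡charge true  true  false _ = refl
toℕ≡charge true  false true  _ = refl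
toℕ≡charge true  false false h with h refl refl
... | ()

size-mono : ∀ {p q} {R S : Rel p q} → R ⊆E S → size R ≤ size S
size-mono {p} {q} {R} {S} R⊆S = Σ-mono-≤ p (λ i → Σ-mono-≤ q (λ j → toℕ-mono (R⊆S i j)))
  where
  toℕ-mono : ∀ {r s} → (r ≡ true → s ≡ true) → toℕ r ≤ toℕ s
  toℕ-mono {false}         _   = z≤n
  toℕ-mono {true}  {true}  _   = ≤-refl
  toℕ-mono {true}  {false} r⇒s with r⇒s refl
  ... | ()

size-cong : ∀ {p q} {R S : Rel p q} → (∀ i j → R i j ≡ S i j) → size R ≡ size S
size-cong {p} {q} R≐S = Σ-cong p (λ i → Σ-cong q (λ j → cong toℕ (R≐S i j)))

module _ {p q : ℕ} (Z : Vertex p q → Bool) where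

  Σ-charge : (R : Rel p q) →
    Σ[< p ] (λ i → Σ[< q ] (λ j → charge (R i j) (Z (inj₁ i)) (Z (inj₂ j))))
      ≡ size (inducedEdges R Z) + bOutside (deg R) Z
  Σ-charge R = begin
    Σ[< p ] (λ i → Σ[< q ] (λ j → inside i j + outˡ i j + outʳ i j))
      ≡⟨ ΣΣ-distrib-+ (λ i j → inside i j + outˡ i j) outʳ ⟩
    Σ[< p ] (λ i → Σ[< q ] (λ j → inside i j + outˡ i j)) + ΣΣ outʳ
      ≡⟨ cong (_+ ΣΣ outʳ) (ΣΣ-distrib-+ inside outˡ) ⟩
    size (inducedEdges R Z) + ΣΣ outˡ + ΣΣ outʳ
      ≡⟨ +-assoc (size (inducedEdges R Z)) _ _ ⟩
    size (inducedEdges R Z) + (ΣΣ outˡ + ΣΣ outʳ)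
      ≡⟨ cong (size (inducedEdges R Z) +_) (cong₂ _+_
           (Σ-cong p (λ i → Σ-if q (Z (inj₁ i)) _))
           (trans (Σ-comm p q outʳ) (Σ-cong q (λ j → Σ-if p (Z (inj₂ j)) _)))) ⟩
    size (inducedEdges R Z) + bOutside (deg R) Z
      ∎
    where
    open ≡-Reasoning
    inside outˡ outʳ : Fin p → Fin q → ℕ
    inside i j = toℕ (inducedEdges R Z i j)
    outˡ i j = if Z (inj₁ i) then 0 else toℕ (R i j)
    outʳ i j = if Z (inj₂ j) then 0 else toℕ (R i j)

    ΣΣ : (Fin p → Fin q → ℕ) → ℕ
    ΣΣ f = Σ[< p ] (λ i → Σ[< q ] (f i))

    ΣΣ-distrib-+ : ∀ f g → ΣΣ (λ i j → f i j + g i j) ≡ ΣΣ f + ΣΣ g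
    ΣΣ-distrib-+ f g = trans (Σ-cong p (λ i → Σ-distrib-+ q (f i) (g i))) (Σ-distrib-+ p _ _)

  size≤inducedEdges+bOutside-deg : (R : Rel p q) → size R ≤ size (inducedEdges R Z) + bOutside (deg R) Z
  size≤inducedEdges+bOutside-deg R = begin
    size R
      ≤⟨ Σ-mono-≤ p (λ i → Σ-mono-≤ q (λ j → toℕ≤charge (R i j) (Z (inj₁ i)) (Z (inj₂ j)))) ⟩
    Σ[< p ] (λ i → Σ[< q ] (λ j → charge (R i j) (Z (inj₁ i)) (Z (inj₂ j))))
      ≡⟨ Σ-charge R ⟩
    size (inducedEdges R Z) + bOutside (deg R) Z
      ∎
    where open ≤-Reasoning

  size≡inducedEdges+bOutside-deg : (R : Rel p q) →
    (∀ i j → Z (inj₁ i) ≡ false → Z (inj₂ j) ≡ false → R i j ≡ false) →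
    size R ≡ size (inducedEdges R Z) + bOutside (deg R) Z
  size≡inducedEdges+bOutside-deg R noEdgeOutside = trans
    (Σ-cong p (λ i → Σ-cong q (λ j → toℕ≡charge (R i j) (Z (inj₁ i)) (Z (inj₂ j)) (noEdgeOutside i j))))
    (Σ-charge R)

  inducedEdges-mono : {R S : Rel p q} → R ⊆E S → inducedEdges R Z ⊆E inducedEdges S Z
  inducedEdges-mono {R} {S} R⊆S i j Rᵢⱼ∧z with R i j in Rᵢⱼ
  ... | true rewrite R⊆S i j Rᵢⱼ = Rᵢⱼ∧z

  inducedEdges-cong : {R S : Rel p q} →
    (∀ i j → Z (inj₁ i) ≡ true → Z (inj₂ j) ≡ true → R i j ≡ S i j) →
    ∀ i j → inducedEdges R Z i j ≡ inducedEdges S Z i j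
  inducedEdges-cong {R} {S} R≐S i j with Z (inj₁ i) in zi | Z (inj₂ j) in zj
  ... | true  | true  = cong (_∧ true) (R≐S i j zi zj)
  ... | true  | false = trans (∧-zeroʳ (R i j)) (sym (∧-zeroʳ (S i j)))
  ... | false | _     = trans (∧-zeroʳ (R i j)) (sym (∧-zeroʳ (S i j)))

  bOutside-mono : {f g : Vertex p q → ℕ} → (∀ v → f v ≤ g v) → bOutside f Z ≤ bOutside g Z
  bOutside-mono f≤g = +-mono-≤
    (Σ-mono-≤ p (λ i → if-mono (Z (inj₁ i)) (f≤g (inj₁ i))))
    (Σ-mono-≤ q (λ j → if-mono (Z (inj₂ j)) (f≤g (inj₂ j))))
    where
    if-mono : ∀ c {x y} → x ≤ y → (if c then 0 else x) ≤ (if c then 0 else y)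
    if-mono true  _   = z≤n
    if-mono false x≤y = x≤y

  bOutside-cong : {f g : Vertex p q → ℕ} → (∀ v → Z v ≡ false → f v ≡ g v) → bOutside f Z ≡ bOutside g Z
  bOutside-cong f≐g = cong₂ _+_
    (Σ-cong p (λ i → if-cong (f≐g (inj₁ i))))
    (Σ-cong q (λ j → if-cong (f≐g (inj₂ j))))
    where
    if-cong : ∀ {v x y} → (Z v ≡ false → x ≡ y) → (if Z v then 0 else x) ≡ (if Z v then 0 else y)
    if-cong {v} x≐y with Z v
    ... | true  = refl
    ... | false = x≐y refl

  bMatching-size≤ : (E : Rel p q) (b : Vertex p q → ℕ) {N : Rel p q} →
    IsBMatching E b N → size N ≤ size (inducedEdges E Z) + bOutside b Z
  bMatching-size≤ E b {N} (N⊆E , deg≤b) = begin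
    size N                                        ≤⟨ size≤inducedEdges+bOutside-deg N ⟩
    size (inducedEdges N Z) + bOutside (deg N) Z  ≤⟨ +-mono-≤ (size-mono (inducedEdges-mono N⊆E))
                                                              (bOutside-mono deg≤b) ⟩
    size (inducedEdges E Z) + bOutside b Z        ∎
    where open ≤-Reasoning

  bMatching-size≡ : (E : Rel p q) (b : Vertex p q → ℕ) {M : Rel p q} → IsBMatching E b M →
    (∀ i j → E i j ≡ true → Z (inj₁ i) ≡ true → Z (inj₂ j) ≡ true → M i j ≡ true) →
    (∀ i j → E i j ≡ true → Z (inj₁ i) ≡ false → Z (inj₂ j) ≡ false → M i j ≡ false) →
    (∀ v → Loose b M v → Z v ≡ true) →
    size M ≡ size (inducedEdges E Z) + bOutside b Z
  bMatching-size≡ E b {M} (M⊆E , deg≤b) inside⊆M outside∩M≡∅ loose⊆Z = begin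
    size M                                        ≡⟨ size≡inducedEdges+bOutside-deg M noEdgeOutside ⟩
    size (inducedEdges M Z) + bOutside (deg M) Z  ≡⟨ cong₂ _+_ (size-cong (inducedEdges-cong M≐E))
                                                               (bOutside-cong saturated) ⟩
    size (inducedEdges E Z) + bOutside b Z        ∎
    where
    open ≡-Reasoning
    noEdgeOutside : ∀ i j → Z (inj₁ i) ≡ false → Z (inj₂ j) ≡ false → M i j ≡ false
    noEdgeOutside i j zi zj with M i j in m
    ... | false = refl
    ... | true  = trans (sym m) (outside∩M≡∅ i j (M⊆E i j m) zi zj)

    M≐E : ∀ i j → Z (inj₁ i) ≡ true → Z (inj₂ j) ≡ true → M i j ≡ E i j
    M≐E i j zi zj = ⇔true⇒≡ (M⊆E i j) (λ e → inside⊆M i j e zi zj)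

    saturated : ∀ v → Z v ≡ false → deg M v ≡ b v
    saturated v zv = ≤-antisym (deg≤b v) (≮⇒≥ (λ loose → contradiction (trans (sym zv) (loose⊆Z v loose)) λ ()))

mainTheorem10 : (p q : ℕ) (E : Rel p q) (b : Vertex p q → ℕ) (M : Rel p q) (Z : Vertex p q → Bool) →
    IsBMatching E b M →
    (∀ i j → E i j ≡ true → Z (inj₁ i) ≡ true → Z (inj₂ j) ≡ true → M i j ≡ true) →
    (∀ i j → E i j ≡ true → Z (inj₁ i) ≡ false → Z (inj₂ j) ≡ false → M i j ≡ false) →
    (∀ v → Loose b M v → Z v ≡ true) →
    IsMaximumBMatching E b M × IsBVerifying E b Z
mainTheorem10 p q E b M Z isBM inside⊆M outside∩M≡∅ loose⊆Z = maximum , (M , maximum , verifying)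
  where
  size-M : size M ≡ size (inducedEdges E Z) + bOutside b Z
  size-M = bMatching-size≡ Z E b isBM inside⊆M outside∩M≡∅ loose⊆Z

  maximum : IsMaximumBMatching E b M
  maximum = isBM , λ N isBN → subst (size N ≤_) (sym size-M) (bMatching-size≤ Z E b isBN)

  verifying : bOutside b Z + size (inducedEdges E Z) ≡ size M
  verifying = trans (+-comm (bOutside b Z) _) (sym size-M)
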